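{- Let $T=\{132,213,231\}$, $k\geq 1$, and $\tau\in S_k(T)$. Then: (i) there exists $r$ with $1\leq r\leq k$ such that $\tau=(k,k-1,\dots,r+1,\;1,2,\dots,r)$; (ii) for all $n\geq k$, $$|S_n(T,(k,\dots,r+1,1,2,\dots,r))|=k-1.$$
   Context: Permutations are written in one-line notation (the run $k,\dots,r+1$ is empty when $r=k$); $S_k$ is the set of permutations of $\{1,\dots,k\}$. A permutation $\alpha\in S_n$ contains a pattern $\beta$ if some subsequence of $\alpha$ is order-isomorphic to $\beta$; otherwise it avoids $\beta$. $S_n(T,\tau)$ is the set of permutations in $S_n$ avoiding all patterns in $T$ and $\tau$. -}

module Defs where

open import Data.Nat using (ℕ; zero; suc; _∸_; _<_)
open import Data.List using (List; []; _∷_; _++_; map; upTo; length; lookup)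
open import Data.List.Relation.Unary.All using (All)
open import Data.List.Relation.Binary.Permutation.Propositional using (_↭_)
open import Data.List.Relation.Binary.Sublist.Propositional using (_⊆_)
open import Data.Fin using (Fin; cast)
open import Data.Product using (Σ; ∃; _×_)
open import Relation.Binary.PropositionalEquality using (_≡_)
open import Relation.Nullary using (¬_)
open import Function.Bundles using (_⇔_)

asc : ℕ → List ℕ
asc n = map suc (upTo n)

-- [k, k-1, ..., r+1]  (empty when r ≥ k)
desc : ℕ → ℕ → List ℕ
desc k r = map (λ i → k ∸ i) (upTo (k ∸ r))

-- one-line notation: w is a permutation of {1,...,n}
IsPerm : ℕ → List ℕ → Set
IsPerm n w = w ↭ asc n

OrderIso : List ℕ → List ℕ → Set
OrderIso s b =
  Σ (length s ≡ length b) λ eq →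
    ∀ (i j : Fin (length s)) →
      (lookup s i < lookup s j) ⇔ (lookup b (cast eq i) < lookup b (cast eq j))

Contains : List ℕ → List ℕ → Set
Contains α β = ∃ λ s → s ⊆ α × OrderIso s β

Avoids : List ℕ → List ℕ → Set
Avoids α β = ¬ Contains α β

T : List (List ℕ)
T = (1 ∷ 3 ∷ 2 ∷ []) ∷ (2 ∷ 1 ∷ 3 ∷ []) ∷ (2 ∷ 3 ∷ 1 ∷ []) ∷ []

InAv : ℕ → List (List ℕ) → List ℕ → List ℕ → Set
InAv n Ts τ w = IsPerm n w × All (Avoids w) Ts × Avoids w τ

pat : ℕ → ℕ → List ℕ
pat k r = desc k r ++ asc r

module Submission where

-- Write downUp m s for (m+s, …, s+1, 1, 2, …, s): entries each exceeding everything after them,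
-- then an increasing run.  That shape passes to subsequences and to order-isomorphic lists, and
-- 132, 213, 231 lack it, so downUp m s avoids T.  Conversely, in a T-avoider the maximum is first
-- or last: entries x before it and y after it would make x, max, y a 132 or a 231.  If it is last,
-- what precedes it is increasing, since otherwise its first entry, 1 and the maximum form a 213.
-- By induction the T-avoiders of length n ≥ 1 are exactly the lists downUp m s with m + s = n and
-- s ≥ 1, which is (i).  Such a list contains downUp m′ r (r ≥ 1) iff r ≤ s and m′ ≤ m, so for
-- n ≥ m′ + r those avoiding downUp m′ r are the ones with m < m′ or s < r: (m′ + r) − 1 of them.

open import Defs
open import Data.Empty using (⊥; ⊥-elim)
open import Data.Fin using (Fin; cast) renaming (zero to fzero; suc to fsuc)
open import Data.Fin.Properties using (cast-involutive)
open import Data.List using (List; []; _∷_; _++_; [_]; map; upTo; applyUpTo; length; lookup)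
open import Data.List.Properties
  using (map-upTo; map-++; map-id-local; applyUpTo-∷ʳ; length-map; length-upTo; length-applyUpTo;
         length-++; ++-assoc; ++-identityʳ; ∷ʳ-injective)
open import Data.List.Membership.Propositional using (_∈_)
open import Data.List.Membership.Propositional.Properties
  using (∈-map⁻; ∈-map⁺; ∈-upTo⁻; ∈-upTo⁺; ∈-applyUpTo⁺; ∈-applyUpTo⁻;
         ∈-++⁻; ∈-++⁺ˡ; ∈-++⁺ʳ; ∈-∃++; ∈-lookup)
open import Data.List.Relation.Binary.Permutation.Propositional
  using (_↭_; ↭-refl; ↭-sym; ↭-trans; ↭-reflexive; prep)
open import Data.List.Relation.Binary.Permutation.Propositional.Properties
  using (++-comm; drop-mid; ↭-singleton-inv; ∈-resp-↭)
open import Data.List.Relation.Binary.Sublist.Propositional using (_⊆_; []; _∷_; _∷ʳ_; ⊆-refl; ⊆-trans)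
open import Data.List.Relation.Binary.Sublist.Propositional.Properties
  using (All-resp-⊆; length-mono-≤; ++⁺; ++⁺ˡ; ++⁺ʳ; []⊆-universal)
open import Data.List.Relation.Unary.All as All using (All; []; _∷_)
import Data.List.Relation.Unary.All.Properties as All
open import Data.List.Relation.Unary.AllPairs using (AllPairs; []; _∷_)
import Data.List.Relation.Unary.AllPairs.Properties as AllPairs
open import Data.List.Relation.Unary.Any using (index)
open import Data.List.Relation.Unary.Any.Properties using (lookup-index)
open import Data.List.Relation.Unary.Unique.Propositional using (Unique)
import Data.List.Relation.Unary.Unique.Propositional.Properties as Unique
open import Data.Nat using (ℕ; zero; suc; _+_; _∸_; _≤_; _<_; z≤n; s≤s; z<s; s<s; _≤?_; _<?_)
open import Data.Nat.Properties
open import Data.Product using (Σ; ∃; ∃₂; _×_; _,_; proj₁; proj₂; map₂; swap)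
open import Data.Sum using (_⊎_; inj₁; inj₂; [_,_]′)
open import Function using (_∘_)
open import Function.Bundles using (_⇔_; mk⇔; Equivalence)
open import Function.Properties.Equivalence using () renaming (sym to ⇔-sym; trans to ⇔-trans)
open import Relation.Binary.Definitions using (tri<; tri≈; tri>)
open import Relation.Binary.PropositionalEquality
  using (_≡_; _≢_; refl; sym; trans; cong; cong₂; subst; subst₂; module ≡-Reasoning)
open import Relation.Nullary using (¬_; yes; no)

-- Sublists and order isomorphism

AllPairs-resp-⊆ : ∀ {A : Set} {R : A → A → Set} {xs ys} → xs ⊆ ys → AllPairs R ys → AllPairs R xs
AllPairs-resp-⊆ []           []         = []
AllPairs-resp-⊆ (_ ∷ʳ xs⊆)   (_ ∷ rys)  = AllPairs-resp-⊆ xs⊆ rys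
AllPairs-resp-⊆ (refl ∷ xs⊆) (ry ∷ rys) = All-resp-⊆ xs⊆ ry ∷ AllPairs-resp-⊆ xs⊆ rys

avoids-⊆ : ∀ {xs ys β} → xs ⊆ ys → Avoids ys β → Avoids xs β
avoids-⊆ xs⊆ys av (t , t⊆xs , t≅β) = av (t , ⊆-trans t⊆xs xs⊆ys , t≅β)

OrderIso-tail : ∀ {x y s b} → OrderIso (x ∷ s) (y ∷ b) → OrderIso s b
OrderIso-tail (eq , cmp) = suc-injective eq , λ i j → cmp (fsuc i) (fsuc j)

OrderIso-headMax : ∀ {x y s b} → OrderIso (x ∷ s) (y ∷ b) → All (_< y) b → All (_< x) s
OrderIso-headMax (_ , cmp) b<y = All.tabulate λ z∈s → subst (_< _) (sym (lookup-index z∈s))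
  (Equivalence.from (cmp (fsuc (index z∈s)) fzero) (All.lookup b<y (∈-lookup _)))

OrderIso-headMin : ∀ {x y s b} → OrderIso (x ∷ s) (y ∷ b) → All (y <_) b → All (x <_) s
OrderIso-headMin (_ , cmp) y<b = All.tabulate λ z∈s → subst (_ <_) (sym (lookup-index z∈s))
  (Equivalence.from (cmp fzero (fsuc (index z∈s))) (All.lookup y<b (∈-lookup _)))

OrderIso-increasing : ∀ {s b} → OrderIso s b → AllPairs _<_ b → AllPairs _<_ s
OrderIso-increasing {[]}    {[]}    _   []         = []
OrderIso-increasing {_ ∷ _} {_ ∷ _} s≅b (y<b ∷ <b) =
  OrderIso-headMin s≅b y<b ∷ OrderIso-increasing (OrderIso-tail s≅b) <b
OrderIso-increasing {_ ∷ _} {[]}    (() , _) _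

OrderIso-sym : ∀ {s b} → OrderIso s b → OrderIso b s
OrderIso-sym {s} {b} (eq , cmp) = sym eq , λ i j →
  ⇔-sym (subst₂ (λ i′ j′ → Less i j ⇔ lookup b i′ < lookup b j′)
                (cast-involutive eq (sym eq) i) (cast-involutive eq (sym eq) j)
                (cmp (cast (sym eq) i) (cast (sym eq) j)))
  where
  Less : Fin (length b) → Fin (length b) → Set
  Less i j = lookup s (cast (sym eq) i) < lookup s (cast (sym eq) j)

lookup-map : ∀ {A B : Set} (f : A → B) xs i → lookup (map f xs) i ≡ f (lookup xs (cast (length-map f xs) i))
lookup-map f (x ∷ xs) fzero    = refl
lookup-map f (x ∷ xs) (fsuc i) = lookup-map f xs i

OrderIso-map : ∀ {f : ℕ → ℕ} → (∀ {a c} → a < c ⇔ f a < f c) → ∀ b → OrderIso (map f b) b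
OrderIso-map {f} f-iso b = length-map f b , λ i j →
  subst₂ (λ u v → u < v ⇔ lookup b (cast _ i) < lookup b (cast _ j))
         (sym (lookup-map f b i)) (sym (lookup-map f b j)) (⇔-sym f-iso)

strictMono⇒<⇔ : ∀ {f : ℕ → ℕ} → (∀ {a c} → a < c → f a < f c) → ∀ {a c} → a < c ⇔ f a < f c
strictMono⇒<⇔ {f} mono {a} {c} = mk⇔ mono reflect
  where
  reflect : f a < f c → a < c
  reflect fa<fc with <-cmp a c
  ... | tri< a<c _ _  = a<c
  ... | tri≈ _ refl _ = ⊥-elim (<-irrefl refl fa<fc)
  ... | tri> _ _ c<a  = ⊥-elim (<-asym fa<fc (mono c<a))

SameOrder : ℕ → ℕ → ℕ → ℕ → Set
SameOrder x y a b = (x < y ⇔ a < b) × (y < x ⇔ b < a)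

sameOrder : ∀ {x y a b} → x < y → a < b → SameOrder x y a b
sameOrder x<y a<b = mk⇔ (λ _ → a<b) (λ _ → x<y) , mk⇔ (⊥-elim ∘ <-asym x<y) (⊥-elim ∘ <-asym a<b)

orderIso₃ : ∀ {x y z a b c} → SameOrder x y a b → SameOrder x z a c → SameOrder y z b c →
            OrderIso (x ∷ y ∷ z ∷ []) (a ∷ b ∷ c ∷ [])
orderIso₃ {x} {y} {z} {a} {b} {c} (xy , yx) (xz , zx) (yz , zy) = refl , cmp
  where
  irrefl⇔ : ∀ {u v : ℕ} → u < u ⇔ v < v
  irrefl⇔ = mk⇔ (⊥-elim ∘ <-irrefl refl) (⊥-elim ∘ <-irrefl refl)
  cmp : (i j : Fin 3) → lookup (x ∷ y ∷ z ∷ []) i < lookup (x ∷ y ∷ z ∷ []) j ⇔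
                        lookup (a ∷ b ∷ c ∷ []) (cast refl i) < lookup (a ∷ b ∷ c ∷ []) (cast refl j)
  cmp fzero               fzero               = irrefl⇔
  cmp fzero               (fsuc fzero)        = xy
  cmp fzero               (fsuc (fsuc fzero)) = xz
  cmp (fsuc fzero)        fzero               = yx
  cmp (fsuc fzero)        (fsuc fzero)        = irrefl⇔
  cmp (fsuc fzero)        (fsuc (fsuc fzero)) = yz
  cmp (fsuc (fsuc fzero)) fzero               = zx
  cmp (fsuc (fsuc fzero)) (fsuc fzero)        = zy
  cmp (fsuc (fsuc fzero)) (fsuc (fsuc fzero)) = irrefl⇔

contains-132 : ∀ {w x y z} → x ∷ y ∷ z ∷ [] ⊆ w → x < z → z < y → Contains w (1 ∷ 3 ∷ 2 ∷ [])
contains-132 sub x<z z<y = _ , sub ,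
  orderIso₃ (sameOrder (<-trans x<z z<y) (s<s z<s)) (sameOrder x<z (s<s z<s))
            (swap (sameOrder z<y (s<s (s<s z<s))))

contains-213 : ∀ {w x y z} → x ∷ y ∷ z ∷ [] ⊆ w → y < x → x < z → Contains w (2 ∷ 1 ∷ 3 ∷ [])
contains-213 sub y<x x<z = _ , sub ,
  orderIso₃ (swap (sameOrder y<x (s<s z<s))) (sameOrder x<z (s<s (s<s z<s)))
            (sameOrder (<-trans y<x x<z) (s<s z<s))

contains-231 : ∀ {w x y z} → x ∷ y ∷ z ∷ [] ⊆ w → z < x → x < y → Contains w (2 ∷ 3 ∷ 1 ∷ [])
contains-231 sub z<x x<y = _ , sub ,
  orderIso₃ (sameOrder x<y (s<s (s<s z<s))) (swap (sameOrder z<x (s<s z<s)))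
            (swap (sameOrder (<-trans z<x x<y) (s<s z<s)))

-- The lists downUp m s

descAbove : ℕ → ℕ → List ℕ
descAbove zero    s = []
descAbove (suc m) s = suc (m + s) ∷ descAbove m s

downUp : ℕ → ℕ → List ℕ
downUp m s = descAbove m s ++ asc s

asc-∷ʳ : ∀ n → asc n ++ [ suc n ] ≡ asc (suc n)
asc-∷ʳ n rewrite map-upTo suc n | map-upTo suc (suc n) = applyUpTo-∷ʳ suc n

asc-bounded : ∀ s → All (_≤ s) (asc s)
asc-bounded s = All.tabulate λ x∈ →
  let (_ , i∈ , x≡) = ∈-map⁻ suc x∈ in subst (_≤ s) (sym x≡) (∈-upTo⁻ i∈)

asc-increasing : ∀ s → AllPairs _<_ (asc s)
asc-increasing s = AllPairs.map⁺ (AllPairs.applyUpTo⁺₁ (λ i → i) s (λ i<j _ → s<s i<j))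

downUp-bounded : ∀ m s → All (_≤ m + s) (downUp m s)
downUp-bounded m s =
  All.++⁺ (descAbove-bounded m) (All.map (λ x≤s → ≤-trans x≤s (m≤n+m s m)) (asc-bounded s))
  where
  descAbove-bounded : ∀ m → All (_≤ m + s) (descAbove m s)
  descAbove-bounded zero    = []
  descAbove-bounded (suc m) = ≤-refl ∷ All.map m≤n⇒m≤1+n (descAbove-bounded m)

length-downUp : ∀ m s → length (downUp m s) ≡ m + s
length-downUp m s = trans (length-++ (descAbove m s)) (cong₂ _+_ (length-descAbove m) length-asc)
  where
  length-descAbove : ∀ m → length (descAbove m s) ≡ m
  length-descAbove zero    = refl
  length-descAbove (suc m) = cong suc (length-descAbove m)
  length-asc : length (asc s) ≡ s
  length-asc = trans (length-map suc (upTo s)) (length-upTo s)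

pat-downUp : ∀ m s → pat (m + s) s ≡ downUp m s
pat-downUp m s = cong (_++ asc s) (begin
  map (m + s ∸_) (upTo (m + s ∸ s)) ≡⟨ cong (λ d → map (m + s ∸_) (upTo d)) (m+n∸n≡m m s) ⟩
  map (m + s ∸_) (upTo m)           ≡⟨ map-upTo (m + s ∸_) m ⟩
  applyUpTo (m + s ∸_) m            ≡⟨ applyUpTo-descAbove m ⟩
  descAbove m s                     ∎)
  where
  open ≡-Reasoning
  applyUpTo-descAbove : ∀ m → applyUpTo (m + s ∸_) m ≡ descAbove m s
  applyUpTo-descAbove zero    = refl
  applyUpTo-descAbove (suc m) = cong (suc (m + s) ∷_) (applyUpTo-descAbove m)

downUp-↭ : ∀ m s → downUp m s ↭ asc (m + s)
downUp-↭ zero    s = ↭-refl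
downUp-↭ (suc m) s = ↭-trans (prep _ (downUp-↭ m s))
  (↭-trans (++-comm [ suc (m + s) ] (asc (m + s))) (↭-reflexive (asc-∷ʳ (m + s))))

downUp-∷ʳ : ∀ m s → downUp m (suc s) ≡ (descAbove m (suc s) ++ asc s) ++ [ suc s ]
downUp-∷ʳ m s = trans (cong (descAbove m (suc s) ++_) (sym (asc-∷ʳ s)))
                      (sym (++-assoc (descAbove m (suc s)) (asc s) [ suc s ]))

downUp-injective : ∀ {m m′ s s′} → downUp m (suc s) ≡ downUp m′ (suc s′) → m ≡ m′ × s ≡ s′
downUp-injective {m} {m′} {s} {s′} eq
  with _ , refl ← ∷ʳ-injective _ _ (trans (sym (downUp-∷ʳ m s)) (trans eq (downUp-∷ʳ m′ s′))) =
  +-cancelʳ-≡ (suc s) m m′ (begin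
    m + suc s                  ≡⟨ length-downUp m (suc s) ⟨
    length (downUp m (suc s))  ≡⟨ cong length eq ⟩
    length (downUp m′ (suc s)) ≡⟨ length-downUp m′ (suc s) ⟩
    m′ + suc s                 ∎) ,
  refl
  where open ≡-Reasoning

data DownUpShape : List ℕ → Set where
  up   : ∀ {w} → AllPairs _<_ w → DownUpShape w
  down : ∀ {x w} → All (_< x) w → DownUpShape w → DownUpShape (x ∷ w)

DownUpShape-⊆ : ∀ {xs ys} → xs ⊆ ys → DownUpShape ys → DownUpShape xs
DownUpShape-⊆ []           _              = up []
DownUpShape-⊆ (_ ∷ʳ xs⊆)   (up (_ ∷ <ys)) = DownUpShape-⊆ xs⊆ (up <ys)
DownUpShape-⊆ (_ ∷ʳ xs⊆)   (down _ sh)    = DownUpShape-⊆ xs⊆ sh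
DownUpShape-⊆ (refl ∷ xs⊆) (up <ys)       = up (AllPairs-resp-⊆ (refl ∷ xs⊆) <ys)
DownUpShape-⊆ (refl ∷ xs⊆) (down ys<y sh) = down (All-resp-⊆ xs⊆ ys<y) (DownUpShape-⊆ xs⊆ sh)

DownUpShape-resp-OrderIso : ∀ {s b} → OrderIso s b → DownUpShape b → DownUpShape s
DownUpShape-resp-OrderIso s≅b (up <b) = up (OrderIso-increasing s≅b <b)
DownUpShape-resp-OrderIso {_ ∷ _} s≅b (down b<y sh) =
  down (OrderIso-headMax s≅b b<y) (DownUpShape-resp-OrderIso (OrderIso-tail s≅b) sh)
DownUpShape-resp-OrderIso {[]} (() , _) (down _ _)

downUp-shape : ∀ m s → DownUpShape (downUp m s)
downUp-shape zero    s = up (asc-increasing s)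
downUp-shape (suc m) s = down (All.map s≤s (downUp-bounded m s)) (downUp-shape m s)

T-unshaped : All (λ β → ¬ DownUpShape β) T
T-unshaped = ¬132 ∷ ¬213 ∷ ¬231 ∷ []
  where
  ¬132 : ¬ DownUpShape (1 ∷ 3 ∷ 2 ∷ [])
  ¬132 (up (_ ∷ (s≤s (s≤s ()) ∷ []) ∷ _))
  ¬132 (down (s≤s () ∷ _) _)
  ¬213 : ¬ DownUpShape (2 ∷ 1 ∷ 3 ∷ [])
  ¬213 (up ((s≤s () ∷ _) ∷ _))
  ¬213 (down (_ ∷ s≤s (s≤s ()) ∷ []) _)
  ¬231 : ¬ DownUpShape (2 ∷ 3 ∷ 1 ∷ [])
  ¬231 (up ((_ ∷ s≤s () ∷ []) ∷ _))
  ¬231 (down (s≤s (s≤s ()) ∷ _) _)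

DownUpShape⇒avoids : ∀ {w β} → DownUpShape w → ¬ DownUpShape β → Avoids w β
DownUpShape⇒avoids {β = β} sh ¬shβ (t , t⊆w , t≅β) =
  ¬shβ (DownUpShape-resp-OrderIso (OrderIso-sym {t} {β} t≅β) (DownUpShape-⊆ t⊆w sh))

downUp-avoids-T : ∀ m s → All (Avoids (downUp m s)) T
downUp-avoids-T m s = All.map (DownUpShape⇒avoids (downUp-shape m s)) T-unshaped

-- Containment among the lists downUp m s

increasing-in-downUp-length≤ : ∀ m {s t} → 1 ≤ s → t ⊆ downUp m s → AllPairs _<_ t → length t ≤ s
increasing-in-downUp-length≤ zero {s} _ t⊆ _ = ≤-trans (length-mono-≤ t⊆) (≤-reflexive (length-downUp 0 s))
increasing-in-downUp-length≤ (suc m) 1≤s (_ ∷ʳ t⊆) <t = increasing-in-downUp-length≤ m 1≤s t⊆ <t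
increasing-in-downUp-length≤ (suc m) {t = _ ∷ []} 1≤s (refl ∷ _) _ = 1≤s
increasing-in-downUp-length≤ (suc m) {s} {_ ∷ _ ∷ _} _ (refl ∷ t⊆) ((x<y ∷ _) ∷ _)
  with y≤ ∷ _ ← All-resp-⊆ t⊆ (downUp-bounded m s) = ⊥-elim (<⇒≱ x<y (m≤n⇒m≤1+n y≤))

below∧above⇒[] : ∀ {x t} → All (_< x) t → All (x <_) t → t ≡ []
below∧above⇒[] []        []        = refl
below∧above⇒[] (y<x ∷ _) (x<y ∷ _) = ⊥-elim (<-asym y<x x<y)

-- The maximum heading the pattern can only be matched in the descending run, and an increasing
-- run of length r only fits into an ascending run of length at least r.
contains⇒≤ : ∀ m {r m₀ s t} → 1 ≤ r → 1 ≤ s →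
             OrderIso t (downUp m r) → t ⊆ downUp m₀ s → r ≤ s × m ≤ m₀
contains⇒≤ zero {r} {m₀} _ 1≤s t≅ t⊆ =
  subst (_≤ _) (trans (proj₁ t≅) (length-downUp 0 r))
        (increasing-in-downUp-length≤ m₀ 1≤s t⊆ (OrderIso-increasing t≅ (asc-increasing r))) ,
  z≤n
contains⇒≤ (suc m) {t = []} _ _ (() , _) _
contains⇒≤ (suc m) {suc r} {s = s} {t = x ∷ t} _ 1≤s x∷t≅ = matchHead
  where
  t<x : All (_< x) t
  t<x = OrderIso-headMax x∷t≅ (All.map s≤s (downUp-bounded m (suc r)))
  t≢[] : t ≢ []
  t≢[] refl = m+1+n≢0 m (sym (trans (proj₁ (OrderIso-tail x∷t≅)) (length-downUp m (suc r))))
  matchHead : ∀ {m₀} → x ∷ t ⊆ downUp m₀ s → suc r ≤ s × suc m ≤ m₀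
  matchHead {zero} x∷t⊆ with x<t ∷ _ ← AllPairs-resp-⊆ x∷t⊆ (asc-increasing s) =
    ⊥-elim (t≢[] (below∧above⇒[] t<x x<t))
  matchHead {suc m₀} (_ ∷ʳ x∷t⊆) = map₂ m≤n⇒m≤1+n (matchHead x∷t⊆)
  matchHead {suc m₀} (refl ∷ t⊆) = map₂ s≤s (contains⇒≤ m z<s 1≤s (OrderIso-tail x∷t≅) t⊆)

asc-⊆ : ∀ {r s} → r ≤ s → asc r ⊆ asc s
asc-⊆ {s = zero}  z≤n = []
asc-⊆ {s = suc s} r≤ with m≤n⇒m<n∨m≡n r≤
... | inj₁ (s≤s r≤s) = subst (_ ⊆_) (asc-∷ʳ s) (++⁺ʳ [ suc s ] (asc-⊆ r≤s))
... | inj₂ refl      = ⊆-refl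

descAbove-⊆ : ∀ {m m₀} s → m ≤ m₀ → descAbove m s ⊆ descAbove m₀ s
descAbove-⊆ {m₀ = zero}   s z≤n = []
descAbove-⊆ {m₀ = suc m₀} s m≤ with m≤n⇒m<n∨m≡n m≤
... | inj₁ (s≤s m≤m₀) = _ ∷ʳ descAbove-⊆ s m≤m₀
... | inj₂ refl       = ⊆-refl

liftAbove : ℕ → ℕ → ℕ → ℕ
liftAbove r d x with x ≤? r
... | yes _ = x
... | no  _ = x + d

liftAbove-mono : ∀ r d {a c} → a < c → liftAbove r d a < liftAbove r d c
liftAbove-mono r d {a} {c} a<c with a ≤? r | c ≤? r
... | yes _   | yes _   = a<c
... | yes _   | no  _   = <-≤-trans a<c (m≤m+n c d)
... | no  a≰r | yes c≤r = ⊥-elim (a≰r (≤-trans (<⇒≤ a<c) c≤r))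
... | no  _   | no  _   = +-monoˡ-< d a<c

liftAbove-below : ∀ r d {x} → x ≤ r → liftAbove r d x ≡ x
liftAbove-below r d {x} x≤r with x ≤? r
... | yes _   = refl
... | no  x≰r = ⊥-elim (x≰r x≤r)

liftAbove-above : ∀ r d {x} → r < x → liftAbove r d x ≡ x + d
liftAbove-above r d {x} r<x with x ≤? r
... | yes x≤r = ⊥-elim (<⇒≱ r<x x≤r)
... | no  _   = refl

≤⇒contains : ∀ {m m₀ r s} → r ≤ s → m ≤ m₀ → Contains (downUp m₀ s) (downUp m r)
≤⇒contains {m} {m₀} {r} {s} r≤s m≤m₀ =
  map lift (downUp m r) ,
  subst (_⊆ downUp m₀ s) (sym lift-downUp) (++⁺ (descAbove-⊆ s m≤m₀) (asc-⊆ r≤s)) ,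
  OrderIso-map (strictMono⇒<⇔ (liftAbove-mono r (s ∸ r))) (downUp m r)
  where
  lift : ℕ → ℕ
  lift = liftAbove r (s ∸ r)
  lift-top : ∀ m → lift (suc (m + r)) ≡ suc (m + s)
  lift-top m = trans (liftAbove-above r (s ∸ r) (s<s (m≤n+m r m)))
                     (cong suc (trans (+-assoc m r (s ∸ r)) (cong (m +_) (m+[n∸m]≡n r≤s))))
  lift-descAbove : ∀ m → map lift (descAbove m r) ≡ descAbove m s
  lift-descAbove zero    = refl
  lift-descAbove (suc m) = cong₂ _∷_ (lift-top m) (lift-descAbove m)
  lift-downUp : map lift (downUp m r) ≡ descAbove m s ++ asc r
  lift-downUp = trans (map-++ lift (descAbove m r) (asc r))
    (cong₂ _++_ (lift-descAbove m) (map-id-local (All.map (liftAbove-below r (s ∸ r)) (asc-bounded r))))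

downUp-contains⇔ : ∀ {m m₀ r s} → 1 ≤ r → 1 ≤ s →
                   Contains (downUp m₀ s) (downUp m r) ⇔ (r ≤ s × m ≤ m₀)
downUp-contains⇔ {m} 1≤r 1≤s = mk⇔ (λ (_ , t⊆ , t≅) → contains⇒≤ m 1≤r 1≤s t≅ t⊆)
                                   (λ (r≤s , m≤m₀) → ≤⇒contains r≤s m≤m₀)

-- Classification of the T-avoiders

IsDownUp : ℕ → List ℕ → Set
IsDownUp n w = ∃₂ λ m s → m + suc s ≡ n × w ≡ downUp m (suc s)

comparable : ∀ {x y} → DownUpShape (x ∷ y ∷ []) → x < y ⊎ y < x
comparable (up ((x<y ∷ []) ∷ _)) = inj₁ x<y
comparable (down (y<x ∷ []) _)   = inj₂ y<x

no-max-between : ∀ {w x y z} → Avoids w (1 ∷ 3 ∷ 2 ∷ []) → Avoids w (2 ∷ 3 ∷ 1 ∷ []) →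
                 x ∷ z ∷ y ∷ [] ⊆ w → x < z → y < z → x < y ⊎ y < x → ⊥
no-max-between av132 _     xzy⊆ _   y<z (inj₁ x<y) = av132 (contains-132 xzy⊆ x<y y<z)
no-max-between _     av231 xzy⊆ x<z _   (inj₂ y<x) = av231 (contains-231 xzy⊆ y<x x<z)

append-max : ∀ {n} u → All (Avoids (u ++ [ suc n ])) T → IsDownUp n u → IsDownUp (suc n) (u ++ [ suc n ])
append-max _ _ (zero , s , refl , refl) = zero , suc s , refl , asc-∷ʳ (suc s)
append-max _ (_ ∷ av213 ∷ _) (suc m , s , refl , refl) =
  ⊥-elim (av213 (contains-213 top-1-max (s<s (≤-trans z<s (m≤n+m (suc s) m))) ≤-refl))
  where
  top-1-max : suc (m + suc s) ∷ 1 ∷ suc (suc (m + suc s)) ∷ [] ⊆ downUp (suc m) (suc s) ++ [ suc (suc (m + suc s)) ]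
  top-1-max = refl ∷ ++⁺ (++⁺ˡ (descAbove m (suc s)) (refl ∷ []⊆-universal _)) (refl ∷ [])

insert-max : ∀ {n} u v → All (Avoids (u ++ suc n ∷ v)) T →
             IsDownUp n (u ++ v) → IsDownUp (suc n) (u ++ suc n ∷ v)
insert-max []      v       _   (m , s , refl , refl) = suc m , s , refl , refl
insert-max (x ∷ u) []      avT (m , s , eq , e) =
  append-max (x ∷ u) avT (m , s , eq , trans (sym (++-identityʳ (x ∷ u))) e)
insert-max (x ∷ u) (y ∷ v) (av132 ∷ _ ∷ av231 ∷ []) (m , s , refl , e) =
  ⊥-elim (no-max-between av132 av231 (refl ∷ ++⁺ˡ u (refl ∷ refl ∷ []⊆-universal v))
                         (s≤s (All.head xy≤)) (s≤s (All.head (All.tail xy≤)))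
                         (comparable (DownUpShape-⊆ xy⊆ (downUp-shape m (suc s)))))
  where
  xy⊆ : x ∷ y ∷ [] ⊆ downUp m (suc s)
  xy⊆ = subst (_ ⊆_) e (refl ∷ ++⁺ˡ u (refl ∷ []⊆-universal v))
  xy≤ : All (_≤ m + suc s) (x ∷ y ∷ [])
  xy≤ = All-resp-⊆ xy⊆ (downUp-bounded m (suc s))

T-avoider⇒IsDownUp : ∀ {n w} → 1 ≤ n → IsPerm n w → All (Avoids w) T → IsDownUp n w
T-avoider⇒IsDownUp {suc n} _ = go n
  where
  go : ∀ n {w} → IsPerm (suc n) w → All (Avoids w) T → IsDownUp (suc n) w
  go zero    w↭ _ = zero , zero , refl , ↭-singleton-inv w↭
  go (suc n) w↭ avT
    with u , v , refl ← ∈-∃++ (∈-resp-↭ (↭-sym w↭) (∈-map⁺ suc (∈-upTo⁺ ≤-refl))) =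
    insert-max u v avT (go n uv↭ (All.map (λ {β} → avoids-⊆ {β = β} uv⊆) avT))
    where
    uv⊆ : u ++ v ⊆ u ++ suc (suc n) ∷ v
    uv⊆ = ++⁺ ⊆-refl (_ ∷ʳ ⊆-refl)
    uv↭ : u ++ v ↭ asc (suc n)
    uv↭ = ↭-trans (drop-mid u (asc (suc n)) (↭-trans w↭ (↭-reflexive (sym (asc-∷ʳ (suc n))))))
                  (↭-reflexive (++-identityʳ _))

-- Counting the avoiders of downUp m r

ShorterRun : ℕ → ℕ → ℕ → List ℕ → Set
ShorterRun n m r w = ∃₂ λ m₀ s₀ → m₀ + suc s₀ ≡ n × w ≡ downUp m₀ (suc s₀) × (m₀ < m ⊎ s₀ < r)

downUp-avoiders : ∀ {n m r w} → InAv (suc n) T (downUp m (suc r)) w ⇔ ShorterRun (suc n) m r w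
downUp-avoiders {n} {m} {r} = mk⇔ to from
  where
  to : ∀ {w} → InAv (suc n) T (downUp m (suc r)) w → ShorterRun (suc n) m r w
  to (w↭ , avT , avτ) with m₀ , s₀ , eq , refl ← T-avoider⇒IsDownUp z<s w↭ avT | m₀ <? m | s₀ <? r
  ... | yes m₀<m | _        = m₀ , s₀ , eq , refl , inj₁ m₀<m
  ... | no  _    | yes s₀<r = m₀ , s₀ , eq , refl , inj₂ s₀<r
  ... | no  m₀≮m | no  s₀≮r =
    ⊥-elim (avτ (Equivalence.from (downUp-contains⇔ z<s z<s) (s≤s (≮⇒≥ s₀≮r) , ≮⇒≥ m₀≮m)))
  from : ∀ {w} → ShorterRun (suc n) m r w → InAv (suc n) T (downUp m (suc r)) w
  from (m₀ , s₀ , eq , refl , shorter) =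
    subst (λ k → downUp m₀ (suc s₀) ↭ asc k) eq (downUp-↭ m₀ (suc s₀)) ,
    downUp-avoids-T m₀ (suc s₀) ,
    λ contains → let (r≤s₀ , m≤m₀) = Equivalence.to (downUp-contains⇔ z<s z<s) contains in
      [ (λ m₀<m → <⇒≱ m₀<m m≤m₀) , (λ s₀<r → <⇒≱ s₀<r (≤-pred r≤s₀)) ]′ shorter

module _ {n m r : ℕ} (k≤n : m + suc r ≤ suc n) where

  private
    m≤n : m ≤ n
    m≤n = ≤-pred (<-≤-trans (m<m+n m z<s) k≤n)
    r≤n : r ≤ n
    r≤n = ≤-pred (≤-trans (m≤n+m (suc r) m) k≤n)
    runs-sum : ∀ {m₀ s₀} → m₀ + suc s₀ ≡ suc n → m₀ + s₀ ≡ n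
    runs-sum {m₀} {s₀} eq = suc-injective (trans (sym (+-suc m₀ s₀)) eq)

  shortDescent : ℕ → List ℕ
  shortDescent j = downUp j (suc (n ∸ j))

  shortAscent : ℕ → List ℕ
  shortAscent i = downUp (n ∸ i) (suc i)

  ∈shortDescents⇒ : ∀ {w} → w ∈ applyUpTo shortDescent m →
                    ∃₂ λ m₀ s₀ → m₀ + suc s₀ ≡ suc n × w ≡ downUp m₀ (suc s₀) × m₀ < m
  ∈shortDescents⇒ w∈ with j , j<m , refl ← ∈-applyUpTo⁻ shortDescent w∈ =
    j , n ∸ j , trans (+-suc j (n ∸ j)) (cong suc (m+[n∸m]≡n (≤-trans (<⇒≤ j<m) m≤n))) , refl , j<m

  ∈shortAscents⇒ : ∀ {w} → w ∈ applyUpTo shortAscent r →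
                   ∃₂ λ m₀ s₀ → m₀ + suc s₀ ≡ suc n × w ≡ downUp m₀ (suc s₀) × s₀ < r
  ∈shortAscents⇒ w∈ with i , i<r , refl ← ∈-applyUpTo⁻ shortAscent w∈ =
    n ∸ i , i , trans (+-suc (n ∸ i) i) (cong suc (m∸n+n≡m (≤-trans (<⇒≤ i<r) r≤n))) , refl , i<r

  shorterRuns : List (List ℕ)
  shorterRuns = applyUpTo shortDescent m ++ applyUpTo shortAscent r

  ∈shorterRuns⇔ : ∀ {w} → w ∈ shorterRuns ⇔ ShorterRun (suc n) m r w
  ∈shorterRuns⇔ {w} = mk⇔ to from
    where
    to : w ∈ shorterRuns → ShorterRun (suc n) m r w
    to w∈ with ∈-++⁻ (applyUpTo shortDescent m) w∈
    ... | inj₁ w∈D = let (m₀ , s₀ , eq , e , m₀<m) = ∈shortDescents⇒ w∈D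
                     in  m₀ , s₀ , eq , e , inj₁ m₀<m
    ... | inj₂ w∈A = let (m₀ , s₀ , eq , e , s₀<r) = ∈shortAscents⇒ w∈A
                     in  m₀ , s₀ , eq , e , inj₂ s₀<r
    from : ShorterRun (suc n) m r w → w ∈ shorterRuns
    from (m₀ , s₀ , eq , refl , inj₁ m₀<m) =
      ∈-++⁺ˡ (subst (λ s → downUp m₀ (suc s) ∈ applyUpTo shortDescent m)
                    (trans (cong (_∸ m₀) (sym (runs-sum eq))) (m+n∸m≡n m₀ s₀))
                    (∈-applyUpTo⁺ shortDescent m₀<m))
    from (m₀ , s₀ , eq , refl , inj₂ s₀<r) =
      ∈-++⁺ʳ (applyUpTo shortDescent m)
             (subst (λ d → downUp d (suc s₀) ∈ applyUpTo shortAscent r)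
                    (trans (cong (_∸ s₀) (sym (runs-sum eq))) (m+n∸n≡m m₀ s₀))
                    (∈-applyUpTo⁺ shortAscent s₀<r))

  shorterRuns-unique : Unique shorterRuns
  shorterRuns-unique = Unique.++⁺
    (Unique.applyUpTo⁺₁ shortDescent m (λ i<j _ e → <⇒≢ i<j (proj₁ (downUp-injective e))))
    (Unique.applyUpTo⁺₁ shortAscent r (λ i<j _ e → <⇒≢ i<j (proj₂ (downUp-injective e))))
    disjoint
    where
    disjoint : ∀ {w} → ¬ (w ∈ applyUpTo shortDescent m × w ∈ applyUpTo shortAscent r)
    disjoint (w∈D , w∈A) with m₀ , s₀ , eq , refl , m₀<m ← ∈shortDescents⇒ w∈D
                            | _ , _ , _ , e , s₀<r ← ∈shortAscents⇒ w∈A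
                            with refl , refl ← downUp-injective e =
      <-irrefl eq (<-≤-trans (+-mono-< m₀<m (s<s s₀<r)) k≤n)

  length-shorterRuns : length shorterRuns ≡ m + suc r ∸ 1
  length-shorterRuns = begin
    length shorterRuns
      ≡⟨ length-++ (applyUpTo shortDescent m) ⟩
    length (applyUpTo shortDescent m) + length (applyUpTo shortAscent r)
      ≡⟨ cong₂ _+_ (length-applyUpTo shortDescent m) (length-applyUpTo shortAscent r) ⟩
    m + r
      ≡⟨ cong (_∸ 1) (+-suc m r) ⟨
    m + suc r ∸ 1
      ∎
    where open ≡-Reasoning

pat-avoiders-enumerated : ∀ {m r} n → m + suc r ≤ n →
  ∃ λ (L : List (List ℕ)) → Unique L × length L ≡ m + suc r ∸ 1 ×
    ((w : List ℕ) → (w ∈ L) ⇔ InAv n T (pat (m + suc r) (suc r)) w)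
pat-avoiders-enumerated {m}     zero    k≤0 = ⊥-elim (m+1+n≢0 m (n≤0⇒n≡0 k≤0))
pat-avoiders-enumerated {m} {r} (suc n) k≤n =
  shorterRuns k≤n , shorterRuns-unique k≤n , length-shorterRuns k≤n ,
  λ w → subst (λ β → w ∈ shorterRuns k≤n ⇔ InAv (suc n) T β w) (sym (pat-downUp m (suc r)))
              (⇔-trans (∈shorterRuns⇔ k≤n) (⇔-sym downUp-avoiders))

theorem9 : (k : ℕ) → 1 ≤ k → (τ : List ℕ) → IsPerm k τ → All (Avoids τ) T →
    Σ ℕ λ r → 1 ≤ r × r ≤ k × τ ≡ pat k r ×
      ((n : ℕ) → k ≤ n →
        ∃ λ (L : List (List ℕ)) → Unique L × length L ≡ k ∸ 1 ×
          ((w : List ℕ) → (w ∈ L) ⇔ InAv n T (pat k r) w))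
theorem9 k 1≤k τ τ↭ avT with T-avoider⇒IsDownUp 1≤k τ↭ avT
... | m , s , refl , refl =
  suc s , z<s , m≤n+m (suc s) m , sym (pat-downUp m (suc s)) , pat-avoiders-enumerated
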